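{- Let $n\ge1$ and let $\lambda\in P(n)$ be a partition at which $N(0,3;\lambda)$ attains its maximum over $P(n)$. Unless $\lambda$ is one of $(3)$, $(6)$, $(16)$, the partition $\lambda$ has no part equal to $3$, $6$ or $16$.
   Context: $P(n)$ is the set of partitions of $n$. $N(0,3;m)$ is the number of partitions of $m$ whose rank (largest part minus number of parts) is divisible by $3$, and for $\lambda=(\lambda_1,\dots,\lambda_k)$, $N(0,3;\lambda):=\prod_{j=1}^kN(0,3;\lambda_j)$. -}

module Defs where

open import Data.Nat using (ℕ; zero; suc; _+_; _∸_; _≤_; _≥_; _⊔_; _⊓_)
open import Data.Nat.Divisibility using (_∣?_)
open import Data.Integer using (ℤ; _-_; +_; ∣_∣)
open import Data.List using (List; []; _∷_; length; map; concatMap; filter; foldr)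
open import Data.Nat.ListAction using (sum; product)
open import Data.List.Relation.Unary.All using (All)
open import Data.List.Relation.Unary.Linked using (Linked)
open import Relation.Binary.PropositionalEquality using (_≡_)
open import Data.Product using (_×_)

IsPartition : ℕ → List ℕ → Set
IsPartition n λs = Linked _≥_ λs × All (λ p → 1 ≤ p) λs × sum λs ≡ n

largest : List ℕ → ℕ
largest = foldr _⊔_ 0

rank : List ℕ → ℤ
rank λs = + largest λs - + length λs

downFrom : ℕ → List ℕ
downFrom zero = []
downFrom (suc j) = suc j ∷ downFrom j

-- all partitions of n with every part ≤ k (fuel f ≥ n suffices)
partsBounded : ℕ → ℕ → ℕ → List (List ℕ)
partsBounded _ zero _ = [] ∷ []
partsBounded zero (suc _) _ = []
partsBounded (suc f) (suc n) k =
  concatMap (λ j → map (j ∷_) (partsBounded f (suc n ∸ j) j)) (downFrom (suc n ⊓ k))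

partitions : ℕ → List (List ℕ)
partitions m = partsBounded m m m

-- N(0,3;m): number of partitions of m whose rank is divisible by 3
-- (integer divisibility 3 ∣ r is, by definition, 3 ∣ ∣ r ∣ on naturals)
N03 : ℕ → ℕ
N03 m = length (filter (λ μ → 3 ∣? ∣ rank μ ∣) (partitions m))

N03P : List ℕ → ℕ
N03P λs = product (map N03 λs)

-- A maximiser λ cannot contain a sub-multiset κ of its parts that some partition ν of the same total
-- beats, N03P ν > N03P κ: replacing κ by ν multiplies N03P λ by N03P ν / N03P κ > 1.
-- If p ∈ {3, 6, 16} is a part of λ ≠ (p), take another part a.  For a ≤ 33 an explicit partition of
-- p + a beats {p, a} (a finite computation).  For a ≥ 34 an explicit partition ν of a beats {a},
-- since N03 a ≤ p(a) < N03P ν: up to 71 by tabulating an upper bound for p(a), and beyond by the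
-- Euler-product bound p(a) ≤ x⁻ᵃ ∏_{j ≤ a} (1 - xʲ)⁻¹ with x = 17/20, which grows by less than the
-- factor 7 = N03 7 gained from each further part 7 of ν.

{-# OPTIONS --safe #-}
module Submission where

open import Defs
open import Data.Nat using (ℕ; zero; suc; _+_; _*_; _∸_; _^_; _≤_; _<_; _≤ᵇ_; z≤n; s≤s; NonZero; >-nonZero)
open import Data.Nat.Properties
open import Data.Nat.DivMod using (_%_; _/_; m≡m%n+[m/n]*n; m%n<n)
open import Data.Nat.Divisibility using (_∣?_)
open import Data.Nat.ListAction using (sum; product)
open import Data.Nat.ListAction.Properties using (sum-++; product-++; sum-↭; product-↭)
open import Data.Nat.Tactic.RingSolver using (solve-∀)
open import Data.Integer using (∣_∣)
open import Data.Bool using (Bool; true; T; if_then_else_)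
open import Data.Bool.Properties using (T-≡)
open import Data.Bool.ListAction using (all)
open import Data.List using (List; []; _∷_; _++_; length; map; concatMap; replicate; reverse; upTo)
open import Data.List.Properties using (map-++; length-++; length-map; length-filter)
open import Data.List.Membership.Propositional using (_∈_)
open import Data.List.Membership.Propositional.Properties using (∈-∃++; ∈-upTo⁺)
open import Data.List.Relation.Unary.All as All using (All; []; _∷_; all?)
open import Data.List.Relation.Unary.All.Properties using (++⁻ʳ; ++⁺; all⁺)
open import Data.List.Relation.Unary.Linked using ([]; [-]; _∷_)
open import Data.List.Relation.Binary.Permutation.Propositional using (_↭_; ↭-refl; ↭-sym; ↭-trans; prep; swap)
open import Data.List.Relation.Binary.Permutation.Propositional.Properties using (All-resp-↭; map⁺; shift)
open import Data.Product using (∃; ∃₂; _×_; _,_)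
open import Data.Sum using (_⊎_; inj₁; inj₂)
open import Function using (_∘_)
open import Function.Bundles using (Equivalence)
open import Relation.Nullary using (Dec; yes; no; does; ¬_; contradiction; _×-dec_; _→-dec_)
open import Relation.Nullary.Decidable using (T?)
open import Relation.Binary.PropositionalEquality hiding ([_])
open import Relation.Binary.Properties.DecTotalOrder ≤-decTotalOrder using (≥-decTotalOrder)
open import Data.List.Sort ≥-decTotalOrder using (sort; sort-↭; sort-↗)
open import Algebra.Properties.CommutativeSemigroup *-commutativeSemigroup using (x∙yz≈y∙xz)

-- Exchanging parts of a maximiser

Maximal : ℕ → List ℕ → Set
Maximal n λs = ∀ μ → IsPartition n μ → N03P μ ≤ N03P λs

Splitting : ℕ → (ℕ → Set) → List ℕ → Set
Splitting m P ν = All (1 ≤_) ν × sum ν ≡ m × P (N03P ν)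

Splittable : ℕ → (ℕ → Set) → Set
Splittable m P = ∃ (Splitting m P)

Improvable : List ℕ → Set
Improvable κ = Splittable (sum κ) (N03P κ <_)

N03P-++ : ∀ xs ys → N03P (xs ++ ys) ≡ N03P xs * N03P ys
N03P-++ xs ys = trans (cong product (map-++ N03 xs ys)) (product-++ (map N03 xs) (map N03 ys))

N03P-↭ : ∀ {xs ys} → xs ↭ ys → N03P xs ≡ N03P ys
N03P-↭ p = product-↭ (map⁺ N03 p)

sort-isPartition : ∀ {n xs} → All (1 ≤_) xs → sum xs ≡ n → IsPartition n (sort xs)
sort-isPartition {xs = xs} pos sum≡n =
  sort-↗ xs , All-resp-↭ (↭-sym (sort-↭ xs)) pos , trans (sum-↭ (sort-↭ xs)) sum≡n

ones-isPartition : ∀ n → IsPartition n (replicate n 1)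
ones-isPartition zero = [] , [] , refl
ones-isPartition (suc zero) = [-] , s≤s z≤n ∷ [] , refl
ones-isPartition (suc (suc n)) with ones-isPartition (suc n)
... | linked , pos , sum≡ = ≤-refl ∷ linked , s≤s z≤n ∷ pos , cong suc sum≡

N03P-ones : ∀ n → N03P (replicate n 1) ≡ 1
N03P-ones zero = refl
N03P-ones (suc n) = cong (1 *_) (N03P-ones n)

maximal-positive : ∀ {n λs} → Maximal n λs → 1 ≤ N03P λs
maximal-positive {n} max = subst (_≤ _) (N03P-ones n) (max _ (ones-isPartition n))

maximal⇒¬improvable : ∀ {n λs κ ρ} → IsPartition n λs → Maximal n λs → λs ↭ κ ++ ρ → ¬ Improvable κ
maximal⇒¬improvable {n} {λs} {κ} {ρ} (_ , pos , sum≡n) max λs↭κρ (ν , posν , sumν , κ<ν) =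
  <⇒≱ λs<μ (max (sort (ν ++ ρ)) (sort-isPartition posμ sumμ))
  where
  posμ : All (1 ≤_) (ν ++ ρ)
  posμ = ++⁺ posν (++⁻ʳ κ (All-resp-↭ λs↭κρ pos))
  sumμ : sum (ν ++ ρ) ≡ n
  sumμ = begin
    sum (ν ++ ρ)      ≡⟨ sum-++ ν ρ ⟩
    sum ν + sum ρ     ≡⟨ cong (_+ sum ρ) sumν ⟩
    sum κ + sum ρ     ≡⟨ sum-++ κ ρ ⟨
    sum (κ ++ ρ)      ≡⟨ sum-↭ λs↭κρ ⟨
    sum λs            ≡⟨ sum≡n ⟩
    n                 ∎
    where open ≡-Reasoning
  λs≡ : N03P λs ≡ N03P κ * N03P ρ
  λs≡ = trans (N03P-↭ λs↭κρ) (N03P-++ κ ρ)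
  instance
    ρ≢0 : NonZero (N03P ρ)
    ρ≢0 = m*n≢0⇒n≢0 (N03P κ) {{subst NonZero λs≡ (>-nonZero (maximal-positive {n} {λs} max))}}
  λs<μ : N03P λs < N03P (sort (ν ++ ρ))
  λs<μ = begin-strict
    N03P λs                ≡⟨ λs≡ ⟩
    N03P κ * N03P ρ        <⟨ *-monoˡ-< (N03P ρ) κ<ν ⟩
    N03P ν * N03P ρ        ≡⟨ N03P-++ ν ρ ⟨
    N03P (ν ++ ρ)          ≡⟨ N03P-↭ (sort-↭ (ν ++ ρ)) ⟨
    N03P (sort (ν ++ ρ))   ∎
    where open ≤-Reasoning

-- Unlike `allUpTo?` from Data.Nat.Properties, this only computes booleans; building the proofs
-- while deciding makes the checks below impractically slow.
allBelow : {P : ℕ → Set} → (∀ n → Dec (P n)) → ℕ → Bool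
allBelow P? v = all (does ∘ P?) (upTo v)

from-does : {A : Set} (a? : Dec A) → T (does a?) → A
from-does (yes a) _ = a

allBelow-sound : {P : ℕ → Set} (P? : ∀ n → Dec (P n)) → ∀ v → allBelow P? v ≡ true → ∀ {n} → n < v → P n
allBelow-sound P? v ok n<v =
  from-does (P? _) (All.lookup (all⁺ (does ∘ P?) (upTo v) (Equivalence.from T-≡ ok)) (∈-upTo⁺ n<v))

allBelow₂ : {P : ℕ → ℕ → Set} → (∀ m n → Dec (P m n)) → ℕ → ℕ → Bool
allBelow₂ P? a b = allBelow (λ m → T? (allBelow (P? m) b)) a

allBelow₂-sound : {P : ℕ → ℕ → Set} (P? : ∀ m n → Dec (P m n)) → ∀ a b → allBelow₂ P? a b ≡ true →
  ∀ {m} → m < a → ∀ {n} → n < b → P m n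
allBelow₂-sound P? a b ok m<a =
  allBelow-sound (P? _) b (Equivalence.to T-≡ (allBelow-sound (λ m → T? (allBelow (P? m) b)) a ok m<a))

splitting? : ∀ m {P : ℕ → Set} → (∀ x → Dec (P x)) → ∀ ν → Dec (Splitting m P ν)
splitting? m P? ν = all? (1 ≤?_) ν ×-dec sum ν ≟ m ×-dec P? (N03P ν)

improvement? : ∀ κ ν → Dec (Splitting (sum κ) (N03P κ <_) ν)
improvement? κ ν = splitting? (sum κ) (N03P κ <?_) ν

splittable-map : ∀ {m} {P Q : ℕ → Set} → (∀ {x} → P x → Q x) → Splittable m P → Splittable m Q
splittable-map P⇒Q (ν , positive , sum≡m , Pν) = ν , positive , sum≡m , P⇒Q {N03P ν} Pν

part-improvable : ∀ {a} → Splittable a (N03 a <_) → Improvable (a ∷ [])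
part-improvable {a} (ν , positive , sum≡a , N03<ν) =
  ν , positive , trans sum≡a (sym (+-identityʳ a)) , subst (_< N03P ν) (sym (*-identityʳ (N03 a))) N03<ν

-- Partitions with bounded parts

boundedCount : ℕ → ℕ → ℕ → ℕ
boundedCount f n k = length (partsBounded f n k)

N03≤boundedCount : ∀ n → N03 n ≤ boundedCount n n n
N03≤boundedCount n = length-filter (λ μ → 3 ∣? ∣ rank μ ∣) (partitions n)

private
  firstParts : ℕ → ℕ → ℕ → List (List ℕ)
  firstParts f n j = concatMap (λ i → map (i ∷_) (partsBounded f (n ∸ i) i)) (downFrom j)

  length-firstParts : ∀ f n j →
    length (firstParts f n (suc j)) ≡ boundedCount f (n ∸ suc j) (suc j) + length (firstParts f n j)
  length-firstParts f n j =
    trans (length-++ (map (suc j ∷_) (partsBounded f (n ∸ suc j) (suc j))))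
          (cong (_+ length (firstParts f n j)) (length-map (suc j ∷_) (partsBounded f (n ∸ suc j) (suc j))))

boundedCount-step : ∀ f n k → k ≤ n →
  boundedCount (suc f) (suc n) (suc k) ≡ boundedCount f (n ∸ k) (suc k) + boundedCount (suc f) (suc n) k
boundedCount-step f n k k≤n
  rewrite m≥n⇒m⊓n≡n k≤n | m≥n⇒m⊓n≡n (m≤n⇒m≤1+n k≤n) = length-firstParts f (suc n) k

boundedCount-cap : ∀ f n k → n < k → boundedCount (suc f) (suc n) (suc k) ≡ boundedCount (suc f) (suc n) k
boundedCount-cap f n k n<k rewrite m≤n⇒m⊓n≡m (<⇒≤ n<k) | m≤n⇒m⊓n≡m n<k = refl

Supersolution : ℕ → (ℕ → ℕ → ℕ) → Set
Supersolution K U =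
  (∀ {k} → k < suc K → 1 ≤ U 0 k) ×
  (∀ {n} → n < suc K → ∀ {k} → k < K → U n k ≤ U n (suc k)) ×
  (∀ {n} → n < suc K → ∀ {k} → k < K → k < n → U (n ∸ suc k) (suc k) + U n k ≤ U n (suc k))

boundedCount≤supersolution : ∀ {K U} → Supersolution K U →
  ∀ f n k → n < suc K → k < suc K → boundedCount f n k ≤ U n k
boundedCount≤supersolution (empty , _) f zero k _ k-bound = empty k-bound
boundedCount≤supersolution _ zero (suc n) k _ _ = z≤n
boundedCount≤supersolution _ (suc f) (suc n) zero _ _ = z≤n
boundedCount≤supersolution {U = U} S@(_ , mono , step) (suc f) (suc n) (suc k) n-bound k-bound with k ≤? n
... | yes k≤n = begin
  boundedCount (suc f) (suc n) (suc k)
    ≡⟨ boundedCount-step f n k k≤n ⟩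
  boundedCount f (n ∸ k) (suc k) + boundedCount (suc f) (suc n) k
    ≤⟨ +-mono-≤ (bound f (n ∸ k) (suc k) (≤-<-trans (m∸n≤m n k) (<⇒≤ n-bound)) k-bound)
                (bound (suc f) (suc n) k n-bound (<⇒≤ k-bound)) ⟩
  U (n ∸ k) (suc k) + U (suc n) k
    ≤⟨ step n-bound (<-pred k-bound) (s≤s k≤n) ⟩
  U (suc n) (suc k)
    ∎
  where open ≤-Reasoning
        bound = boundedCount≤supersolution S
... | no k≰n = begin
  boundedCount (suc f) (suc n) (suc k)   ≡⟨ boundedCount-cap f n k (≰⇒> k≰n) ⟩
  boundedCount (suc f) (suc n) k         ≤⟨ boundedCount≤supersolution S (suc f) (suc n) k n-bound (<⇒≤ k-bound) ⟩
  U (suc n) k                            ≤⟨ mono n-bound (<-pred k-bound) ⟩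
  U (suc n) (suc k)                      ∎
  where open ≤-Reasoning

module _ (U : ℕ → ℕ → ℕ) where

  empty? : ∀ k → Dec (1 ≤ U 0 k)
  empty? k = 1 ≤? U 0 k

  mono? : ∀ n k → Dec (U n k ≤ U n (suc k))
  mono? n k = U n k ≤? U n (suc k)

  step? : ∀ n k → Dec (k < n → U (n ∸ suc k) (suc k) + U n k ≤ U n (suc k))
  step? n k = k <? n →-dec U (n ∸ suc k) (suc k) + U n k ≤? U n (suc k)

  supersolution : ∀ K → allBelow empty? (suc K) ≡ true →
    allBelow₂ mono? (suc K) K ≡ true → allBelow₂ step? (suc K) K ≡ true → Supersolution K U
  supersolution K empty mono step =
    allBelow-sound empty? (suc K) empty , allBelow₂-sound mono? (suc K) K mono , allBelow₂-sound step? (suc K) K step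

index : {A : Set} → A → List A → ℕ → A
index default []       _       = default
index default (x ∷ xs) zero    = x
index default (x ∷ xs) (suc i) = index default xs i

module PartitionTable (K : ℕ) where

  -- Row n lists p(n, ≤ k) for k = 0 … K, using p(n, ≤ k) = p(n, ≤ k-1) + p(n-k, ≤ k); `earlier` holds
  -- the rows n-1, …, 0, passed as an argument (to `extend` below) so that evaluation shares them.
  row : ℕ → List (List ℕ) → List ℕ
  row n earlier = from 0 (if n ≤ᵇ 0 then 1 else 0) (suc K)
    where
    from : ℕ → ℕ → ℕ → List ℕ
    from k acc zero       = []
    from k acc (suc fuel) = acc ∷ from (suc k) (acc + (if suc k ≤ᵇ n then index 0 (index [] earlier k) (suc k) else 0)) fuel

  rowsDown : ℕ → List (List ℕ)
  rowsDown zero    = row 0 [] ∷ []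
  rowsDown (suc n) = extend (rowsDown n)
    where extend : List (List ℕ) → List (List ℕ)
          extend earlier = row (suc n) earlier ∷ earlier

  table : List (List ℕ)
  table = reverse (rowsDown K)

entry : List (List ℕ) → ℕ → ℕ → ℕ
entry T n k = index 0 (index [] T n) k

-- Entry r ≤ 23 is a partition of r maximising N03P among those with parts ≤ 16 (found by exhaustive
-- search); heavyPartition tops it up with parts 7, which give the largest growth rate N03 7 ^ (1/7).
smallHeavy : List (List ℕ)
smallHeavy =
  [] ∷ (1 ∷ []) ∷ (1 ∷ 1 ∷ []) ∷ (3 ∷ []) ∷ (4 ∷ []) ∷ (4 ∷ 1 ∷ []) ∷ (6 ∷ []) ∷ (7 ∷ []) ∷
  (4 ∷ 4 ∷ []) ∷ (9 ∷ []) ∷ (10 ∷ []) ∷ (7 ∷ 4 ∷ []) ∷ (4 ∷ 4 ∷ 4 ∷ []) ∷ (13 ∷ []) ∷ (7 ∷ 7 ∷ []) ∷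
  (7 ∷ 4 ∷ 4 ∷ []) ∷ (16 ∷ []) ∷ (10 ∷ 7 ∷ []) ∷ (7 ∷ 7 ∷ 4 ∷ []) ∷ (7 ∷ 4 ∷ 4 ∷ 4 ∷ []) ∷ (13 ∷ 7 ∷ []) ∷
  (7 ∷ 7 ∷ 7 ∷ []) ∷ (7 ∷ 7 ∷ 4 ∷ 4 ∷ []) ∷ (13 ∷ 10 ∷ []) ∷ []

heavyPartition : ℕ → List ℕ
heavyPartition m = replicate q 7 ++ index [] smallHeavy (m ∸ 7 * q)
  where q = (m ∸ 17) / 7

-- Opaque, so that comparing types never evaluates the table; only the checks below unfold it.
opaque
  partitionTable : List (List ℕ)
  partitionTable = PartitionTable.table 71

midRange? : (T : List (List ℕ)) → ∀ i → Dec (Splitting (34 + i) (entry T (34 + i) (34 + i) <_) (heavyPartition (34 + i)))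
midRange? T i = splitting? (34 + i) (entry T (34 + i) (34 + i) <?_) (heavyPartition (34 + i))

opaque
  unfolding partitionTable

  partitionTable-supersolution : Supersolution 71 (entry partitionTable)
  partitionTable-supersolution = supersolution (entry partitionTable) 71 refl refl refl

  midRange-checked : allBelow (midRange? partitionTable) 38 ≡ true
  midRange-checked = refl

midRange-improvable : ∀ {i} → i < 38 → Improvable (34 + i ∷ [])
midRange-improvable {i} i<38 =
  part-improvable (splittable-map (λ {x} → N03< {x})
    (heavyPartition a , allBelow-sound (midRange? partitionTable) 38 midRange-checked i<38))
  where
  a = 34 + i
  N03< : ∀ {x} → entry partitionTable a a < x → N03 a < x
  N03< = ≤-<-trans (≤-trans (N03≤boundedCount a) (boundedCount≤supersolution partitionTable-supersolution a a a a<72 a<72))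
    where a<72 = +-monoʳ-< 34 i<38

-- The Euler-product bound

∏pow : ℕ → ℕ → ℕ
∏pow t zero    = 1
∏pow t (suc k) = t ^ suc k * ∏pow t k

∏gap : ℕ → ℕ → ℕ → ℕ
∏gap s t zero    = 1
∏gap s t (suc k) = (t ^ suc k ∸ s ^ suc k) * ∏gap s t k

∏gap≤∏pow : ∀ s t k → ∏gap s t k ≤ ∏pow t k
∏gap≤∏pow s t zero    = ≤-refl
∏gap≤∏pow s t (suc k) = *-mono-≤ (m∸n≤m (t ^ suc k) (s ^ suc k)) (∏gap≤∏pow s t k)

^-split : ∀ b {m n} → m ≤ n → b ^ n ≡ b ^ m * b ^ (n ∸ m)
^-split b {m} {n} m≤n = trans (cong (b ^_) (sym (m+[n∸m]≡n m≤n))) (^-distribˡ-+-* b m (n ∸ m))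

-- The two terms of the recursion for p(n, ≤ k) get weights w = sᵏ and u - w = tᵏ - sᵏ, adding up to u = tᵏ.
euler-step : ∀ {w u s′ t′ G E c₁ c₂} → w ≤ u →
  s′ * ((u ∸ w) * G) * c₁ ≤ t′ * (u * E) → w * s′ * G * c₂ ≤ u * t′ * E →
  w * s′ * ((u ∸ w) * G) * (c₁ + c₂) ≤ u * t′ * (u * E)
euler-step {w} {u} {s′} {t′} {G} {E} {c₁} {c₂} w≤u bound₁ bound₂ = begin
  w * s′ * ((u ∸ w) * G) * (c₁ + c₂)
    ≡⟨ distribute w s′ (u ∸ w) G c₁ c₂ ⟩
  w * (s′ * ((u ∸ w) * G) * c₁) + (u ∸ w) * (w * s′ * G * c₂)
    ≤⟨ +-mono-≤ (*-monoʳ-≤ w bound₁) (*-monoʳ-≤ (u ∸ w) bound₂) ⟩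
  w * (t′ * (u * E)) + (u ∸ w) * (u * t′ * E)
    ≡⟨ collect w (u ∸ w) t′ u E ⟩
  ((u ∸ w) + w) * (u * t′ * E)
    ≡⟨ cong (_* (u * t′ * E)) (m∸n+n≡m w≤u) ⟩
  u * (u * t′ * E)
    ≡⟨ reassociate u t′ E ⟩
  u * t′ * (u * E)
    ∎
  where
  open ≤-Reasoning
  distribute : ∀ w s′ v G c₁ c₂ → w * s′ * (v * G) * (c₁ + c₂) ≡ w * (s′ * (v * G) * c₁) + v * (w * s′ * G * c₂)
  distribute = solve-∀
  collect : ∀ w v t′ u E → w * (t′ * (u * E)) + v * (u * t′ * E) ≡ (v + w) * (u * t′ * E)
  collect = solve-∀
  reassociate : ∀ u t′ E → u * (u * t′ * E) ≡ u * t′ * (u * E)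
  reassociate = solve-∀

-- The Euler-product bound p(n, ≤ k) ≤ x⁻ⁿ ∏_{j ≤ k} (1 - xʲ)⁻¹ at x = s / t, with denominators cleared.
boundedCount-euler : ∀ {s t} → s ≤ t → ∀ f n k → s ^ n * ∏gap s t k * boundedCount f n k ≤ t ^ n * ∏pow t k
boundedCount-euler {s} {t} _ f zero k = begin
  1 * ∏gap s t k * 1   ≡⟨ *-identityʳ _ ⟩
  1 * ∏gap s t k       ≤⟨ *-monoʳ-≤ 1 (∏gap≤∏pow s t k) ⟩
  1 * ∏pow t k         ∎
  where open ≤-Reasoning
boundedCount-euler {s} {t} _ zero    (suc n) k    = ≤-trans (≤-reflexive (*-zeroʳ (s ^ suc n * ∏gap s t k))) z≤n
boundedCount-euler {s} {t} _ (suc f) (suc n) zero = ≤-trans (≤-reflexive (*-zeroʳ (s ^ suc n * 1))) z≤n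
boundedCount-euler {s} {t} s≤t (suc f) (suc n) (suc k) with k ≤? n
... | yes k≤n rewrite boundedCount-step f n k k≤n | ^-split s (s≤s k≤n) | ^-split t (s≤s k≤n) =
  euler-step (^-monoˡ-≤ (suc k) s≤t) (boundedCount-euler s≤t f (n ∸ k) (suc k)) bound₂
  where
  bound₂ : s ^ suc k * s ^ (n ∸ k) * ∏gap s t k * boundedCount (suc f) (suc n) k ≤ t ^ suc k * t ^ (n ∸ k) * ∏pow t k
  bound₂ = subst₂ (λ x y → x * ∏gap s t k * boundedCount (suc f) (suc n) k ≤ y * ∏pow t k)
                  (^-split s (s≤s k≤n)) (^-split t (s≤s k≤n)) (boundedCount-euler s≤t (suc f) (suc n) k)
... | no k≰n rewrite boundedCount-cap f n k (≰⇒> k≰n) = begin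
  s ^ suc n * (gap * G) * c  ≡⟨ rearrange (s ^ suc n) gap G c ⟩
  gap * (s ^ suc n * G * c)  ≤⟨ *-mono-≤ (m∸n≤m (t ^ suc k) (s ^ suc k)) (boundedCount-euler s≤t (suc f) (suc n) k) ⟩
  t ^ suc k * (t ^ suc n * E) ≡⟨ x∙yz≈y∙xz (t ^ suc k) (t ^ suc n) E ⟩
  t ^ suc n * (t ^ suc k * E) ∎
  where
  open ≤-Reasoning
  gap = t ^ suc k ∸ s ^ suc k
  G = ∏gap s t k
  E = ∏pow t k
  c = boundedCount (suc f) (suc n) k
  rearrange : ∀ x v G c → x * (v * G) * c ≡ v * (x * G * c)
  rearrange = solve-∀

∏gap-nonZero : ∀ {s t} → s < t → ∀ k → NonZero (∏gap s t k)
∏gap-nonZero s<t zero    = _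
∏gap-nonZero {s} {t} s<t (suc k) =
  m*n≢0 _ _ {{>-nonZero (m<n⇒0<n∸m (^-monoˡ-< (suc k) s<t))}} {{∏gap-nonZero s<t k}}

^-dominance : ∀ {c s t j} → s ≤ t → c * s ^ j ≤ t ^ j → ∀ i → c * s ^ (i + j) ≤ t ^ (i + j)
^-dominance _   c*sʲ≤tʲ zero    = c*sʲ≤tʲ
^-dominance {c} {s} {t} {j} s≤t c*sʲ≤tʲ (suc i) = begin
  c * (s * s ^ (i + j))  ≡⟨ x∙yz≈y∙xz c s _ ⟩
  s * (c * s ^ (i + j))  ≤⟨ *-mono-≤ s≤t (^-dominance {c} s≤t c*sʲ≤tʲ i) ⟩
  t * t ^ (i + j)        ∎
  where open ≤-Reasoning

-- Opaque for the same reason as partitionTable.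
opaque
  eulerNum eulerDen : ℕ → ℕ
  eulerNum a = 20 ^ a * ∏pow 20 a
  eulerDen a = 17 ^ a * ∏gap 17 20 a

opaque
  unfolding eulerNum eulerDen

  eulerDen*boundedCount≤eulerNum : ∀ a → eulerDen a * boundedCount a a a ≤ eulerNum a
  eulerDen*boundedCount≤eulerNum a = boundedCount-euler (≤ᵇ⇒≤ 17 20 _) a a a

  eulerDen-nonZero : ∀ a → NonZero (eulerDen a)
  eulerDen-nonZero a = m*n≢0 (17 ^ a) _ {{m^n≢0 17 a}} {{∏gap-nonZero (<ᵇ⇒< 17 20 _) a}}

  eulerNum-suc : ∀ k → eulerNum (suc k) ≡ (20 * 20 ^ suc k) * eulerNum k
  eulerNum-suc k = lemma (20 ^ k) (20 ^ suc k) (∏pow 20 k)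
    where lemma : ∀ p q e → (20 * p) * (q * e) ≡ (20 * q) * (p * e)
          lemma = solve-∀

  eulerDen-suc : ∀ k → eulerDen (suc k) ≡ (17 * (20 ^ suc k ∸ 17 ^ suc k)) * eulerDen k
  eulerDen-suc k = lemma (17 ^ k) (20 ^ suc k ∸ 17 ^ suc k) (∏gap 17 20 k)
    where lemma : ∀ p q e → (17 * p) * (q * e) ≡ (17 * q) * (p * e)
          lemma = solve-∀

-- (17/20)ʲ ≤ 1/10 for j ≥ 15, so each factor 20/(17 (1 - (17/20)ʲ)) of eulerNum/eulerDen is at most 200/153.
eulerRatio-step : ∀ {k} → 14 ≤ k → 153 * (20 * 20 ^ suc k) ≤ 200 * (17 * (20 ^ suc k ∸ 17 ^ suc k))
eulerRatio-step {k} 14≤k = begin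
  153 * (20 * u)               ≡⟨ lhs u ⟩
  3060 * u                     ≤⟨ m+n≤o⇒m≤o∸n (3060 * u) 3060u+3400w≤3400u ⟩
  3400 * u ∸ 3400 * w          ≡⟨ *-distribˡ-∸ 3400 u w ⟨
  3400 * (u ∸ w)               ≡⟨ rhs (u ∸ w) ⟩
  200 * (17 * (u ∸ w))         ∎
  where
  open ≤-Reasoning
  u = 20 ^ suc k
  w = 17 ^ suc k
  10w≤u : 10 * w ≤ u
  10w≤u = subst (λ j → 10 * 17 ^ j ≤ 20 ^ j) (m∸n+n≡m (s≤s 14≤k))
    (^-dominance {10} {17} {20} {15} (≤ᵇ⇒≤ 17 20 _) (≤ᵇ⇒≤ (10 * 17 ^ 15) (20 ^ 15) _) (suc k ∸ 15))
  3060u+3400w≤3400u : 3060 * u + 3400 * w ≤ 3400 * u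
  3060u+3400w≤3400u = subst₂ _≤_ (middle u w) (right u) (+-monoʳ-≤ (3060 * u) (*-monoʳ-≤ 340 10w≤u))
    where middle : ∀ u w → 3060 * u + 340 * (10 * w) ≡ 3060 * u + 3400 * w
          middle = solve-∀
          right : ∀ u → 3060 * u + 340 * u ≡ 3400 * u
          right = solve-∀
  lhs : ∀ u → 153 * (20 * u) ≡ 3060 * u
  lhs = solve-∀
  rhs : ∀ x → 3400 * x ≡ 200 * (17 * x)
  rhs = solve-∀

eulerRatio-steps : ∀ m {k} → 14 ≤ k → 153 ^ m * (eulerNum (m + k) * eulerDen k) ≤ 200 ^ m * (eulerNum k * eulerDen (m + k))
eulerRatio-steps zero    _    = ≤-refl
eulerRatio-steps (suc m) {k} 14≤k = begin
  153 * 153 ^ m * (eulerNum (suc (m + k)) * eulerDen k)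
    ≡⟨ cong (λ x → 153 * 153 ^ m * (x * eulerDen k)) (eulerNum-suc (m + k)) ⟩
  153 * 153 ^ m * (α * eulerNum (m + k) * eulerDen k)
    ≡⟨ regroup 153 (153 ^ m) α (eulerNum (m + k)) (eulerDen k) ⟩
  (153 * α) * (153 ^ m * (eulerNum (m + k) * eulerDen k))
    ≤⟨ *-mono-≤ (eulerRatio-step (≤-trans 14≤k (m≤n+m k m))) (eulerRatio-steps m 14≤k) ⟩
  (200 * β) * (200 ^ m * (eulerNum k * eulerDen (m + k)))
    ≡⟨ regroup′ 200 (200 ^ m) β (eulerNum k) (eulerDen (m + k)) ⟨
  200 * 200 ^ m * (eulerNum k * (β * eulerDen (m + k)))
    ≡⟨ cong (λ x → 200 * 200 ^ m * (eulerNum k * x)) (eulerDen-suc (m + k)) ⟨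
  200 * 200 ^ m * (eulerNum k * eulerDen (suc (m + k)))
    ∎
  where
  open ≤-Reasoning
  α = 20 * 20 ^ suc (m + k)
  β = 17 * (20 ^ suc (m + k) ∸ 17 ^ suc (m + k))
  regroup : ∀ c p a x y → c * p * (a * x * y) ≡ (c * a) * (p * (x * y))
  regroup = solve-∀
  regroup′ : ∀ c p b x y → c * p * (x * (b * y)) ≡ (c * b) * (p * (x * y))
  regroup′ = solve-∀

eulerTail-step : ∀ {a x} → 14 ≤ a → eulerNum a < eulerDen a * x → eulerNum (7 + a) < eulerDen (7 + a) * (7 * x)
eulerTail-step {a} {x} 14≤a h = *-cancelʳ-< (eulerDen a) _ _ (*-cancelˡ-< (153 ^ 7) _ _ (begin-strict
  153 ^ 7 * (eulerNum (7 + a) * eulerDen a)          ≤⟨ eulerRatio-steps 7 14≤a ⟩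
  200 ^ 7 * (eulerNum a * eulerDen (7 + a))          <⟨ *-monoʳ-< (200 ^ 7) (*-monoˡ-< (eulerDen (7 + a)) {{eulerDen-nonZero (7 + a)}} h) ⟩
  200 ^ 7 * (eulerDen a * x * eulerDen (7 + a))      ≤⟨ *-monoˡ-≤ (eulerDen a * x * eulerDen (7 + a)) 200⁷≤7*153⁷ ⟩
  7 * 153 ^ 7 * (eulerDen a * x * eulerDen (7 + a))  ≡⟨ rearrange (153 ^ 7) (eulerDen a) x (eulerDen (7 + a)) ⟩
  153 ^ 7 * (eulerDen (7 + a) * (7 * x) * eulerDen a) ∎))
  where
  open ≤-Reasoning
  200⁷≤7*153⁷ : 200 ^ 7 ≤ 7 * 153 ^ 7
  200⁷≤7*153⁷ = ≤ᵇ⇒≤ (200 ^ 7) (7 * 153 ^ 7) _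
  rearrange : ∀ c d x d′ → 7 * c * (d * x * d′) ≡ c * (d′ * (7 * x) * d)
  rearrange = solve-∀

EulerSplittable : ℕ → Set
EulerSplittable a = Splittable a (λ x → eulerNum a < eulerDen a * x)

eulerBase? : ∀ r → Dec (Splitting (72 + r) (λ x → eulerNum (72 + r) < eulerDen (72 + r) * x) (heavyPartition (72 + r)))
eulerBase? r = splitting? (72 + r) (λ x → eulerNum (72 + r) <? eulerDen (72 + r) * x) (heavyPartition (72 + r))

opaque
  unfolding eulerNum eulerDen

  eulerBase-checked : allBelow eulerBase? 7 ≡ true
  eulerBase-checked = refl

eulerSplittable-base : ∀ {r} → r < 7 → EulerSplittable (72 + r)
eulerSplittable-base {r} r<7 = heavyPartition (72 + r) , allBelow-sound eulerBase? 7 eulerBase-checked r<7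

eulerSplittable-step : ∀ {a} → 14 ≤ a → EulerSplittable a → EulerSplittable (7 + a)
eulerSplittable-step 14≤a (ν , positive , sum≡a , bound) =
  7 ∷ ν , s≤s z≤n ∷ positive , cong (7 +_) sum≡a , eulerTail-step 14≤a bound

eulerSplittable : ∀ a → 72 ≤ a → EulerSplittable a
eulerSplittable a 72≤a = subst EulerSplittable a≡ (iterate q)
  where
  q = (a ∸ 72) / 7
  r = (a ∸ 72) % 7
  iterate : ∀ i → EulerSplittable (i * 7 + (72 + r))
  iterate zero    = eulerSplittable-base (m%n<n (a ∸ 72) 7)
  iterate (suc i) =
    eulerSplittable-step (≤-trans (≤ᵇ⇒≤ 14 72 _) (≤-trans (m≤m+n 72 r) (m≤n+m (72 + r) (i * 7)))) (iterate i)
  a≡ : q * 7 + (72 + r) ≡ a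
  a≡ = begin
    q * 7 + (72 + r)   ≡⟨ shuffle q r ⟩
    72 + (r + q * 7)   ≡⟨ cong (72 +_) (m≡m%n+[m/n]*n (a ∸ 72) 7) ⟨
    72 + (a ∸ 72)      ≡⟨ m+[n∸m]≡n 72≤a ⟩
    a                  ∎
    where
    open ≡-Reasoning
    shuffle : ∀ q r → q * 7 + (72 + r) ≡ 72 + (r + q * 7)
    shuffle = solve-∀

tail-improvable : ∀ {a} → 72 ≤ a → Improvable (a ∷ [])
tail-improvable {a} 72≤a = part-improvable (splittable-map (λ {x} → N03< {x}) (eulerSplittable a 72≤a))
  where
  N03< : ∀ {x} → eulerNum a < eulerDen a * x → N03 a < x
  N03< bound = *-cancelˡ-< (eulerDen a) _ _
    (≤-<-trans (≤-trans (*-monoʳ-≤ (eulerDen a) (N03≤boundedCount a)) (eulerDen*boundedCount≤eulerNum a)) bound)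

large-part-improvable : ∀ {a} → 34 ≤ a → Improvable (a ∷ [])
large-part-improvable {a} 34≤a with a ≤? 71
... | yes a≤71 = subst (λ m → Improvable (m ∷ [])) (m+[n∸m]≡n 34≤a) (midRange-improvable (s≤s (∸-monoˡ-≤ 34 a≤71)))
... | no a≰71  = tail-improvable (≰⇒> a≰71)

-- Parts 3, 6 and 16

pairImprovement? : ∀ p a → Dec (Splitting (sum (p ∷ suc a ∷ [])) (N03P (p ∷ suc a ∷ []) <_) (heavyPartition (p + suc a)))
pairImprovement? p a = improvement? (p ∷ suc a ∷ []) (heavyPartition (p + suc a))

pair-improvable : ∀ p → allBelow (pairImprovement? p) 33 ≡ true → ∀ {a} → 1 ≤ a → a ≤ 33 → Improvable (p ∷ a ∷ [])
pair-improvable p checked {suc a} _ a≤33 = heavyPartition (p + suc a) , allBelow-sound (pairImprovement? p) 33 checked a≤33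

pairs-3-checked : allBelow (pairImprovement? 3) 33 ≡ true
pairs-3-checked = refl

pairs-6-checked : allBelow (pairImprovement? 6) 33 ≡ true
pairs-6-checked = refl

pairs-16-checked : allBelow (pairImprovement? 16) 33 ≡ true
pairs-16-checked = refl

∈⇒↭-two-parts : ∀ {p λs} → p ∈ λs → λs ≢ p ∷ [] → ∃₂ λ (a : ℕ) ρ → λs ↭ p ∷ a ∷ ρ
∈⇒↭-two-parts {p} p∈λs λs≢p with ∈-∃++ p∈λs
... | []     , []     , refl = contradiction refl λs≢p
... | []     , a ∷ ρ  , refl = a , ρ , ↭-refl
... | a ∷ xs , ys     , refl = a , xs ++ ys , ↭-trans (prep a (shift p xs ys)) (swap a p ↭-refl)

part-absent : ∀ {p n λs} → (∀ {a} → 1 ≤ a → a ≤ 33 → Improvable (p ∷ a ∷ [])) →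
  IsPartition n λs → Maximal n λs → λs ≢ p ∷ [] → ¬ p ∈ λs
part-absent {p} pairs isP@(_ , positive , _) max λs≢p p∈λs
  with a , ρ , λs↭ ← ∈⇒↭-two-parts p∈λs λs≢p
  with _ ∷ 1≤a ∷ _ ← All-resp-↭ λs↭ positive
  with a ≤? 33
... | yes a≤33 = maximal⇒¬improvable {κ = p ∷ a ∷ []} isP max λs↭ (pairs 1≤a a≤33)
... | no a≰33  = maximal⇒¬improvable {κ = a ∷ []} isP max (↭-trans λs↭ (swap p a ↭-refl)) (large-part-improvable (≰⇒> a≰33))

proposition3p3 : (n : ℕ) → 1 ≤ n → (λs : List ℕ) → IsPartition n λs
    → (∀ (μ : List ℕ) → IsPartition n μ → N03P μ ≤ N03P λs)
    → λs ≢ 3 ∷ [] → λs ≢ 6 ∷ [] → λs ≢ 16 ∷ []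
    → ¬ (3 ∈ λs ⊎ 6 ∈ λs ⊎ 16 ∈ λs)
proposition3p3 _ _ _ isP max λs≢3 _ _ (inj₁ 3∈λs) = part-absent (pair-improvable 3 pairs-3-checked) isP max λs≢3 3∈λs
proposition3p3 _ _ _ isP max _ λs≢6 _ (inj₂ (inj₁ 6∈λs)) = part-absent (pair-improvable 6 pairs-6-checked) isP max λs≢6 6∈λs
proposition3p3 _ _ _ isP max _ _ λs≢16 (inj₂ (inj₂ 16∈λs)) = part-absent (pair-improvable 16 pairs-16-checked) isP max λs≢16 16∈λs
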